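{- Let $n\ge2$, $W=W(B_n)$, $c=[1\,2\ldots n]$ and $c=lr$ a bipartition of $c$. Then the dihedral group $\mathcal{D}=\langle\varphi_l,\varphi_r\rangle$ of lattice automorphisms of $\mathrm{NC}(W,c)$ has order $2n$.
   Context: $W(B_n)$ is the group of signed permutations of $\{\pm1,\ldots,\pm n\}$ (bijections with $w(-i)=-w(i)$); $[i_1\ldots i_k]$ denotes $(i_1\ldots i_k\,-i_1\ldots-i_k)$. Its reflections are $T=\{(i\,j)(-i\,-j):1\le i<|j|\le n\}\cup\{(i\,-i):1\le i\le n\}$; $\ell$ is length with respect to $T$, the absolute order is $u\le w$ iff $\ell(w)=\ell(u)+\ell(u^{ -1}w)$, and $\mathrm{NC}(W,c)=\{w:w\le c\}$. A bipartition is $c=lr$ with $l^2=r^2=\mathrm{id}$; $\varphi_l(w)=lw^{ -1}l$, $\varphi_r(w)=rw^{ -1}r$. -}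

module Defs where

open import Data.Nat using (ℕ; zero; suc; _+_; _*_; _<_; _≤_)
open import Data.Nat.Properties using (_<?_)
open import Data.Bool using (Bool; true; false; not; if_then_else_)
open import Data.Fin using (Fin; toℕ; fromℕ<) renaming (zero to fzero)
open import Data.Fin.Properties using () renaming (_≟_ to _≟F_)
open import Data.Bool.Properties using () renaming (_≟_ to _≟B_)
open import Data.Product using (Σ; _×_; _,_; proj₁; proj₂; ∃)
open import Data.Product.Properties using (≡-dec)
open import Data.Sum using (_⊎_)
open import Data.List using (List; []; _∷_)
open import Data.Vec using (Vec; lookup)
open import Data.Vec.Relation.Unary.All using (All)
open import Relation.Binary.PropositionalEquality using (_≡_; _≢_)
open import Relation.Nullary using (¬_; yes; no; Dec)

-- Signed elements ±1,…,±n : (false , i) is +(i+1), (true , i) is -(i+1).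
SE : ℕ → Set
SE n = Bool × Fin n

neg : ∀ {n} → SE n → SE n
neg (b , i) = (not b , i)

_≟SE_ : ∀ {n} (x y : SE n) → Dec (x ≡ y)
_≟SE_ = ≡-dec _≟B_ _≟F_

record SPerm (n : ℕ) : Set where
  field
    fun   : SE n → SE n
    inv   : SE n → SE n
    fun∘inv : ∀ x → fun (inv x) ≡ x
    inv∘fun : ∀ x → inv (fun x) ≡ x
    odd   : ∀ x → fun (neg x) ≡ neg (fun x)
open SPerm public

_≈_ : ∀ {n} → SPerm n → SPerm n → Set
u ≈ w = ∀ x → fun u x ≡ fun w x

idP : ∀ {n} → SPerm n
idP = record { fun = λ x → x ; inv = λ x → x ; fun∘inv = λ _ → Relation.Binary.PropositionalEquality.refl
             ; inv∘fun = λ _ → Relation.Binary.PropositionalEquality.refl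
             ; odd = λ _ → Relation.Binary.PropositionalEquality.refl }

_·_ : ∀ {n} → SPerm n → SPerm n → SPerm n
u · w = record
  { fun = λ x → fun u (fun w x)
  ; inv = λ x → inv w (inv u x)
  ; fun∘inv = λ x → trans (cong (fun u) (fun∘inv w (inv u x))) (fun∘inv u x)
  ; inv∘fun = λ x → trans (cong (inv w) (inv∘fun u (fun w x))) (inv∘fun w x)
  ; odd = λ x → trans (cong (fun u) (odd w x)) (odd u (fun w x)) }
  where open Relation.Binary.PropositionalEquality using (trans; cong)

_⁻¹ : ∀ {n} → SPerm n → SPerm n
w ⁻¹ = record
  { fun = inv w ; inv = fun w ; fun∘inv = inv∘fun w ; inv∘fun = fun∘inv w
  ; odd = λ x → trans (sym (inv∘fun w (inv w (neg x))))
                 (trans (cong (inv w) (trans (fun∘inv w (neg x))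
                        (sym (cong neg (fun∘inv w x)))))
                 (trans (cong (inv w) (sym (odd w (inv w x)))) (inv∘fun w (neg (inv w x))))) }
  where open Relation.Binary.PropositionalEquality using (trans; cong; sym)

swap : ∀ {n} → SE n → SE n → SE n → SE n
swap a b x with x ≟SE a
... | yes _ = b
... | no _ with x ≟SE b
...   | yes _ = a
...   | no _ = x

-- Reflections of W(B_n):
--   (i j)(-i -j) with 1 ≤ i < |j| ≤ n   (j may be negative), and
--   (i -i) with 1 ≤ i ≤ n.
IsReflection : ∀ {n} → SPerm n → Set
IsReflection {n} t =
  (Σ (Fin n) λ i → Σ (Bool × Fin n) λ j → (toℕ i < toℕ (proj₂ j)) ×
     (∀ x → fun t x ≡ swap (false , i) j (swap (true , i) (neg j) x)))
  ⊎ (Σ (Fin n) λ i → ∀ x → fun t x ≡ swap (false , i) (true , i) x)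

prodV : ∀ {n k} → Vec (SPerm n) k → SPerm n
prodV Vec.[] = idP
prodV (t Vec.∷ ts) = t · prodV ts

ProdOf : ∀ {n} → ℕ → SPerm n → Set
ProdOf {n} k w = Σ (Vec (SPerm n) k) λ ts → All IsReflection ts × (prodV ts ≈ w)

IsLength : ∀ {n} → SPerm n → ℕ → Set
IsLength w k = ProdOf k w × (∀ m → m < k → ¬ ProdOf m w)

_≤T_ : ∀ {n} → SPerm n → SPerm n → Set
u ≤T w = Σ ℕ λ a → Σ ℕ λ b →
  IsLength u a × IsLength ((u ⁻¹) · w) b × IsLength w (a + b)

InNC : ∀ {n} → SPerm n → SPerm n → Set
InNC c w = w ≤T c

-- the Coxeter element c = [1 2 … n] = (1 2 … n -1 -2 … -n)
cfun : ∀ {n} → SE n → SE n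
cfun {suc k} (b , i) with suc (toℕ i) <? suc k
... | yes p = (b , fromℕ< p)
... | no _ = (not b , fzero)

IsCoxC : ∀ {n} → SPerm n → Set
IsCoxC c = ∀ x → fun c x ≡ cfun x

Bipartition : ∀ {n} → SPerm n → SPerm n → SPerm n → Set
Bipartition c l r = ((l · l) ≈ idP) × ((r · r) ≈ idP) × ((l · r) ≈ c)

φ : ∀ {n} → SPerm n → SPerm n → SPerm n
φ x w = (x · (w ⁻¹)) · x

-- elements of ⟨φ_l, φ_r⟩ as words (true = φ_l, false = φ_r);
-- both generators are involutions, so words give the whole generated group
evalWord : ∀ {n} → SPerm n → SPerm n → List Bool → SPerm n → SPerm n
evalWord l r [] w = w
evalWord l r (true ∷ ws) w = φ l (evalWord l r ws w)
evalWord l r (false ∷ ws) w = φ r (evalWord l r ws w)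

-- two elements of 𝒟 are equal iff they agree as maps on NC(W,c)
SameOnNC : ∀ {n} → SPerm n → SPerm n → SPerm n → List Bool → List Bool → Set
SameOnNC c l r u v = ∀ w → InNC c w → evalWord l r u w ≈ evalWord l r v w

DihedralOrder : ∀ {n} → SPerm n → SPerm n → SPerm n → ℕ → Set
DihedralOrder c l r m =
  Σ (Vec (List Bool) m) λ ws →
    (∀ i j → i ≢ j → ¬ SameOnNC c l r (lookup ws i) (lookup ws j))
    × (∀ v → Σ (Fin m) λ i → SameOnNC c l r v (lookup ws i))

-- Write ψ = φ_r ∘ φ_l. As l² = r² = 1 and c = l r, ψ(w) = c⁻¹ w c, and c^n = −1 is central, so ψ^n = 1
-- and every element of ⟨φ_l, φ_r⟩ is ψ^a or φ_l ψ^a with 0 ≤ a < n.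
-- To separate these 2n maps we use t = (1 −1) and s₁ = (1 2)(−1 −2). Both lie in NC(W, c), being first
-- factors of c = t s₁ s₂ ⋯ s_{n−1} = s₁ s₂ ⋯ s_{n−1} (n −n) with s_i = (i i+1)(−i −i−1), a factorisation
-- which is reduced because ℓ(c) ≥ n: a product of k reflections preserves a labelling of ±[n] with at
-- least 2n − 2k labels, while c is a single 2n-cycle.
-- Now ψ^a(t) negates c^{−a}(1), which ψ^b(t) fixes for a ≠ b. And ψ^a = φ_l ψ^b on t and s₁ would make
-- W = c^a l c^{−b} commute with t and s₁ while W c = c⁻¹ W: then W(1) = ±1, so W(2) = W(s₁(1)) = ±2,
-- yet W(2) = W(c(1)) = c⁻¹(±1) = ∓n.

module Submission where

open import Defs
open import Data.Nat using (ℕ; zero; suc; _+_; _*_; _≤_; _<_; _∸_; z≤n; s≤s; z<s; s<s⁻¹; s≤s⁻¹)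
open import Data.Nat.Properties
open import Data.Bool using (Bool; true; false; not)
open import Data.Bool.Properties using (not-involutive; not-¬)
open import Data.Empty using (⊥; ⊥-elim)
open import Data.Fin using (Fin; toℕ; fromℕ; fromℕ<; combine; remQuot)
  renaming (zero to fzero; suc to fsuc; _≟_ to _≟F_)
open import Data.Fin.Properties
  using ( toℕ-injective; toℕ-fromℕ<; fromℕ<-toℕ; fromℕ<-cong; toℕ<n; toℕ-fromℕ
        ; remQuot-combine; combine-remQuot)
  renaming (suc-injective to fsuc-injective)
open import Data.Product using (Σ; _×_; _,_; proj₁; proj₂; uncurry)
open import Data.Sum using (_⊎_; inj₁; inj₂)
open import Data.List using (List; []; _∷_)
open import Data.Vec using (Vec; []; _∷_; _++_; tabulate; lookup)
open import Data.Vec.Properties using (lookup∘tabulate)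
open import Data.Vec.Relation.Unary.All using (All; []; _∷_)
open import Data.Vec.Relation.Unary.All.Properties using (++⁺)
open import Relation.Binary.PropositionalEquality hiding (J)
open import Relation.Nullary using (¬_; yes; no)
open import Relation.Binary.Definitions using (tri<; tri≈; tri>)
open import Function using (_∘_; id)
open import Algebra.Properties.Monoid.Sum +-0-monoid using (sum; sum-syntax; sum-cong-≗; sum-replicate-zero)

-- Signed transpositions and reflections

module _ {n : ℕ} where

  neg-involutive : (x : SE n) → neg (neg x) ≡ x
  neg-involutive (b , i) = cong (_, i) (not-involutive b)

  neg-injective : {x y : SE n} → neg x ≡ neg y → x ≡ y
  neg-injective {x} {y} e = trans (sym (neg-involutive x)) (trans (cong neg e) (neg-involutive y))

  neg-≢ : (x : SE n) → neg x ≢ x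
  neg-≢ (false , i) ()
  neg-≢ (true , i) ()

  swap-left : (a b : SE n) → swap a b a ≡ b
  swap-left a b with a ≟SE a
  ... | yes _ = refl
  ... | no a≢a = ⊥-elim (a≢a refl)

  swap-right : (a b : SE n) → swap a b b ≡ a
  swap-right a b with b ≟SE a
  ... | yes b≡a = b≡a
  ... | no _ with b ≟SE b
  ...   | yes _ = refl
  ...   | no b≢b = ⊥-elim (b≢b refl)

  swap-other : (a b x : SE n) → x ≢ a → x ≢ b → swap a b x ≡ x
  swap-other a b x x≢a x≢b with x ≟SE a
  ... | yes x≡a = ⊥-elim (x≢a x≡a)
  ... | no _ with x ≟SE b
  ...   | yes x≡b = ⊥-elim (x≢b x≡b)
  ...   | no _ = refl

  swap-cases : (P : SE n → Set) (a b : SE n) → P a → P b → (∀ x → x ≢ a → x ≢ b → P x) → ∀ x → P x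
  swap-cases P a b Pa Pb Po x with x ≟SE a
  ... | yes refl = Pa
  ... | no x≢a with x ≟SE b
  ...   | yes refl = Pb
  ...   | no x≢b = Po x x≢a x≢b

  swap-involutive : (a b x : SE n) → swap a b (swap a b x) ≡ x
  swap-involutive a b = swap-cases _ a b
    (trans (cong (swap a b) (swap-left a b)) (swap-right a b))
    (trans (cong (swap a b) (swap-right a b)) (swap-left a b))
    (λ x x≢a x≢b → trans (cong (swap a b) (swap-other a b x x≢a x≢b)) (swap-other a b x x≢a x≢b))

  swap-sym : (a b x : SE n) → swap a b x ≡ swap b a x
  swap-sym a b = swap-cases _ a b
    (trans (swap-left a b) (sym (swap-right b a)))
    (trans (swap-right a b) (sym (swap-left b a)))
    (λ x x≢a x≢b → trans (swap-other a b x x≢a x≢b) (sym (swap-other b a x x≢b x≢a)))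

  neg-swap : (a b x : SE n) → neg (swap a b x) ≡ swap (neg a) (neg b) (neg x)
  neg-swap a b = swap-cases _ a b
    (trans (cong neg (swap-left a b)) (sym (swap-left (neg a) (neg b))))
    (trans (cong neg (swap-right a b)) (sym (swap-right (neg a) (neg b))))
    (λ x x≢a x≢b → trans (cong neg (swap-other a b x x≢a x≢b))
       (sym (swap-other (neg a) (neg b) (neg x) (x≢a ∘ neg-injective) (x≢b ∘ neg-injective))))

  swap-invariant : (F : SE n → SE n) (a b : SE n) → F a ≡ F b → ∀ x → F (swap a b x) ≡ F x
  swap-invariant F a b Fa≡Fb = swap-cases _ a b
    (trans (cong F (swap-left a b)) (sym Fa≡Fb))
    (trans (cong F (swap-right a b)) Fa≡Fb)
    (λ x x≢a x≢b → cong F (swap-other a b x x≢a x≢b))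

  swap-commute : (a b a' b' : SE n) → a ≢ a' → a ≢ b' → b ≢ a' → b ≢ b' →
                 ∀ x → swap a b (swap a' b' x) ≡ swap a' b' (swap a b x)
  swap-commute a b a' b' a≢a' a≢b' b≢a' b≢b' = swap-cases _ a b
    (trans (cong (swap a b) (swap-other a' b' a a≢a' a≢b'))
           (trans (swap-left a b) (sym (trans (cong (swap a' b') (swap-left a b)) (swap-other a' b' b b≢a' b≢b')))))
    (trans (cong (swap a b) (swap-other a' b' b b≢a' b≢b'))
           (trans (swap-right a b) (sym (trans (cong (swap a' b') (swap-right a b)) (swap-other a' b' a a≢a' a≢b')))))
    (λ x x≢a x≢b → trans (swap-other a b _ (moved x≢a a≢a' a≢b') (moved x≢b b≢a' b≢b'))
                         (cong (swap a' b') (sym (swap-other a b x x≢a x≢b))))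
    where
    moved : ∀ {x y} → x ≢ y → y ≢ a' → y ≢ b' → swap a' b' x ≢ y
    moved {x} {y} x≢y y≢a' y≢b' e =
      x≢y (trans (sym (swap-involutive a' b' x)) (trans (cong (swap a' b') e) (swap-other a' b' y y≢a' y≢b')))

  signedInvolution : (f : SE n → SE n) → (∀ x → f (f x) ≡ x) → (∀ x → f (neg x) ≡ neg (f x)) → SPerm n
  signedInvolution f f∘f f-odd = record { fun = f ; inv = f ; fun∘inv = f∘f ; inv∘fun = f∘f ; odd = f-odd }

  flipAt : Fin n → SPerm n
  flipAt i = signedInvolution (swap (false , i) (true , i)) (swap-involutive _ _)
    (λ x → sym (trans (neg-swap (false , i) (true , i) x) (swap-sym (true , i) (false , i) (neg x))))

  transposeAt : Fin n → Fin n → SPerm n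
  transposeAt i j = signedInvolution f f∘f f-odd
    where
    A B A⁻ B⁻ : SE n
    A = (false , i)
    B = (false , j)
    A⁻ = (true , i)
    B⁻ = (true , j)
    f : SE n → SE n
    f x = swap A B (swap A⁻ B⁻ x)
    commute : ∀ x → swap A⁻ B⁻ (swap A B x) ≡ swap A B (swap A⁻ B⁻ x)
    commute = swap-commute A⁻ B⁻ A B (λ ()) (λ ()) (λ ()) (λ ())
    f∘f : ∀ x → f (f x) ≡ x
    f∘f x = trans (cong (swap A B) (commute (swap A⁻ B⁻ x)))
      (trans (swap-involutive A B _) (swap-involutive A⁻ B⁻ x))
    f-odd : ∀ x → f (neg x) ≡ neg (f x)
    f-odd x = sym (trans (neg-swap A B (swap A⁻ B⁻ x))
      (trans (cong (swap A⁻ B⁻) (neg-swap A⁻ B⁻ x)) (commute (neg x))))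

  flipAt-isReflection : ∀ i → IsReflection (flipAt i)
  flipAt-isReflection i = inj₂ (i , λ _ → refl)

  transposeAt-isReflection : ∀ {i j} → toℕ i < toℕ j → IsReflection (transposeAt i j)
  transposeAt-isReflection {i} {j} i<j = inj₁ (i , (false , j) , i<j , λ _ → refl)

  flipAt-same : ∀ b i → fun (flipAt i) (b , i) ≡ (not b , i)
  flipAt-same false i = swap-left (false , i) (true , i)
  flipAt-same true i = swap-right (false , i) (true , i)

  flipAt-other : ∀ b {i k} → k ≢ i → fun (flipAt i) (b , k) ≡ (b , k)
  flipAt-other b {i} {k} k≢i = swap-other (false , i) (true , i) (b , k) (k≢i ∘ cong proj₂) (k≢i ∘ cong proj₂)

  transposeAt-left : ∀ b i j → fun (transposeAt i j) (b , i) ≡ (b , j)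
  transposeAt-left false i j =
    trans (cong (swap (false , i) (false , j)) (swap-other (true , i) (true , j) (false , i) (λ ()) (λ ())))
          (swap-left (false , i) (false , j))
  transposeAt-left true i j =
    trans (cong (swap (false , i) (false , j)) (swap-left (true , i) (true , j)))
          (swap-other (false , i) (false , j) (true , j) (λ ()) (λ ()))

  transposeAt-right : ∀ b i j → fun (transposeAt i j) (b , j) ≡ (b , i)
  transposeAt-right false i j =
    trans (cong (swap (false , i) (false , j)) (swap-other (true , i) (true , j) (false , j) (λ ()) (λ ())))
          (swap-right (false , i) (false , j))
  transposeAt-right true i j =
    trans (cong (swap (false , i) (false , j)) (swap-right (true , i) (true , j)))
          (swap-other (false , i) (false , j) (true , i) (λ ()) (λ ()))

  transposeAt-other : ∀ b {i j k} → k ≢ i → k ≢ j → fun (transposeAt i j) (b , k) ≡ (b , k)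
  transposeAt-other b {i} {j} {k} k≢i k≢j =
    trans (cong (swap (false , i) (false , j)) (swap-other (true , i) (true , j) (b , k) k≢⁺i k≢⁺j))
          (swap-other (false , i) (false , j) (b , k) k≢⁺i k≢⁺j)
    where
    k≢⁺i : ∀ {b′} → (b , k) ≢ (b′ , i)
    k≢⁺i = k≢i ∘ cong proj₂
    k≢⁺j : ∀ {b′} → (b , k) ≢ (b′ , j)
    k≢⁺j = k≢j ∘ cong proj₂

  flipAt-negates : ∀ {i x} → fun (flipAt i) x ≡ neg x → proj₂ x ≡ i
  flipAt-negates {i} {b , j} t≡neg with j ≟F i
  ... | yes j≡i = j≡i
  ... | no j≢i = ⊥-elim (neg-≢ (b , j) (trans (sym t≡neg) (flipAt-other b j≢i)))

  prodV-++ : ∀ {a b} (xs : Vec (SPerm n) a) (ys : Vec (SPerm n) b) → prodV (xs ++ ys) ≈ (prodV xs · prodV ys)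
  prodV-++ [] ys x = refl
  prodV-++ (t ∷ xs) ys x = cong (fun t) (prodV-++ xs ys x)

  ProdOf-resp-≈ : ∀ {k} {u v : SPerm n} → u ≈ v → ProdOf k u → ProdOf k v
  ProdOf-resp-≈ u≈v (ts , refls , ts≈u) = ts , refls , λ x → trans (ts≈u x) (u≈v x)

  ProdOf-reflection : ∀ {t : SPerm n} → IsReflection t → ProdOf 1 t
  ProdOf-reflection {t} t-refl = t ∷ [] , t-refl ∷ [] , λ _ → refl

  ProdOf-· : ∀ {a b} {u v : SPerm n} → ProdOf a u → ProdOf b v → ProdOf (a + b) (u · v)
  ProdOf-· {u = u} (ts , ts-refl , ts≈u) (ss , ss-refl , ss≈v) =
    ts ++ ss , ++⁺ ts-refl ss-refl ,
    λ x → trans (prodV-++ ts ss x) (trans (cong (fun (prodV ts)) (ss≈v x)) (ts≈u _))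

  reducedPrefix-≤T : ∀ {a b} {u v w : SPerm n} → ProdOf a u → ProdOf b v → (u · v) ≈ w →
                     (∀ m → m < a + b → ¬ ProdOf m w) → u ≤T w
  reducedPrefix-≤T {a} {b} {u} {v} {w} pu pv uv≈w reduced =
    a , b , (pu , shorter-u) , (ProdOf-resp-≈ {b} {v} {(u ⁻¹) · w} v≈u⁻¹w pv , shorter-u⁻¹w) ,
    (ProdOf-resp-≈ {a + b} {u · v} {w} uv≈w (ProdOf-· {a} {b} {u} {v} pu pv) , reduced)
    where
    v≈u⁻¹w : v ≈ ((u ⁻¹) · w)
    v≈u⁻¹w x = trans (sym (inv∘fun u (fun v x))) (cong (inv u) (uv≈w x))
    shorter-u : ∀ m → m < a → ¬ ProdOf m u
    shorter-u m m<a pm = reduced (m + b) (+-monoˡ-< b m<a)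
      (ProdOf-resp-≈ {m + b} {u · v} {w} uv≈w (ProdOf-· {m} {b} {u} {v} pm pv))
    shorter-u⁻¹w : ∀ m → m < b → ¬ ProdOf m ((u ⁻¹) · w)
    shorter-u⁻¹w m m<b pm = reduced (a + m) (+-monoʳ-< a m<b)
      (ProdOf-resp-≈ {a + m} {u · ((u ⁻¹) · w)} {w} (λ x → fun∘inv u (fun w x))
        (ProdOf-· {a} {m} {u} {(u ⁻¹) · w} pu pm))

-- Products of adjacent transpositions

+-suc-≡ : ∀ {j k m} → j + suc k ≡ m → suc j + k ≡ m
+-suc-≡ {j} {k} e = trans (sym (+-suc j k)) e

+-suc-≡⇒< : ∀ {j k m} → j + suc k ≡ m → j < m
+-suc-≡⇒< {j} e = subst (j <_) e (m<m+n j z<s)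

module _ {m : ℕ} where

  record IsCycleFrom (j : ℕ) (Y : SPerm (suc m)) : Set where
    field
      fixes  : ∀ b (i : Fin (suc m)) → toℕ i < j → fun Y (b , i) ≡ (b , i)
      shifts : ∀ b (i : Fin (suc m)) → j ≤ toℕ i → (q : suc (toℕ i) < suc m) → fun Y (b , i) ≡ (b , fromℕ< q)
      wraps  : ∀ b (i : Fin (suc m)) → toℕ i ≡ m → (j<n : j < suc m) → fun Y (b , i) ≡ (b , fromℕ< j<n)
  open IsCycleFrom

  isCycleFrom-id : IsCycleFrom m idP
  isCycleFrom-id = record
    { fixes  = λ _ _ _ → refl
    ; shifts = λ _ i m≤i q → ⊥-elim (≤⇒≯ m≤i (s<s⁻¹ q))
    ; wraps  = λ b i i≡m j<n → cong (b ,_) (toℕ-injective (trans i≡m (sym (toℕ-fromℕ< j<n))))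
    }

  adjacent : ∀ {j} → j < m → SPerm (suc m)
  adjacent j<m = transposeAt (fromℕ< (m<n⇒m<1+n j<m)) (fromℕ< (s≤s j<m))

  adjacent-isReflection : ∀ {j} (j<m : j < m) → IsReflection (adjacent j<m)
  adjacent-isReflection {j} j<m = transposeAt-isReflection
    (subst₂ _<_ (sym (toℕ-fromℕ< (m<n⇒m<1+n j<m))) (sym (toℕ-fromℕ< (s≤s j<m))) (n<1+n j))

  isCycleFrom-adjacent : ∀ {j Y} (j<m : j < m) → IsCycleFrom (suc j) Y → IsCycleFrom j (adjacent j<m · Y)
  isCycleFrom-adjacent {j} {Y} j<m Y-cycle = record
    { fixes  = λ b i i<j → trans (cong (fun (adjacent j<m)) (fixes Y-cycle b i (m<n⇒m<1+n i<j)))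
                                 (transposeAt-other b (≢J (<⇒≢ i<j)) (≢J′ (<⇒≢ (m<n⇒m<1+n i<j))))
    ; shifts = shifts′
    ; wraps  = λ b i i≡m _ → trans (cong (fun (adjacent j<m)) (wraps Y-cycle b i i≡m (s≤s j<m)))
                                   (transposeAt-right b J J′)
    }
    where
    J J′ : Fin (suc m)
    J = fromℕ< (m<n⇒m<1+n j<m)
    J′ = fromℕ< (s≤s j<m)
    ≢J : ∀ {i : Fin (suc m)} → toℕ i ≢ j → i ≢ J
    ≢J i≢j i≡J = i≢j (trans (cong toℕ i≡J) (toℕ-fromℕ< (m<n⇒m<1+n j<m)))
    ≢J′ : ∀ {i : Fin (suc m)} → toℕ i ≢ suc j → i ≢ J′
    ≢J′ i≢j i≡J′ = i≢j (trans (cong toℕ i≡J′) (toℕ-fromℕ< (s≤s j<m)))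
    shifts′ : ∀ b i → j ≤ toℕ i → (q : suc (toℕ i) < suc m) →
              fun (adjacent j<m · Y) (b , i) ≡ (b , fromℕ< q)
    shifts′ b i j≤i q with m≤n⇒m<n∨m≡n j≤i
    ... | inj₁ j<i = trans (cong (fun (adjacent j<m)) (shifts Y-cycle b i j<i q))
                           (transposeAt-other b (≢J (λ e → <⇒≢ (m<n⇒m<1+n j<i) (sym (trans i+1≡ e))))
                                                (≢J′ (λ e → <⇒≢ j<i (sym (suc-injective (trans i+1≡ e))))))
      where
      i+1≡ : suc (toℕ i) ≡ toℕ (fromℕ< q)
      i+1≡ = sym (toℕ-fromℕ< q)
    ... | inj₂ j≡i = begin
      fun (adjacent j<m) (fun Y (b , i)) ≡⟨ cong (fun (adjacent j<m)) (fixes Y-cycle b i i<j+1) ⟩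
      fun (adjacent j<m) (b , i)         ≡⟨ cong (λ k → fun (adjacent j<m) (b , k)) i≡J ⟩
      fun (adjacent j<m) (b , J)         ≡⟨ transposeAt-left b J J′ ⟩
      (b , J′)                           ≡⟨ cong (b ,_) (fromℕ<-cong _ _ (cong suc j≡i) (s≤s j<m) q) ⟩
      (b , fromℕ< q)                     ∎
      where
      open ≡-Reasoning
      i<j+1 : toℕ i < suc j
      i<j+1 = subst (_< suc j) j≡i (n<1+n j)
      i≡J : i ≡ J
      i≡J = toℕ-injective (trans (sym j≡i) (sym (toℕ-fromℕ< (m<n⇒m<1+n j<m))))

  adjacentFrom : ∀ j k → j + k ≡ m → Vec (SPerm (suc m)) k
  adjacentFrom j zero _ = []
  adjacentFrom j (suc k) j+k+1≡m = adjacent (+-suc-≡⇒< j+k+1≡m) ∷ adjacentFrom (suc j) k (+-suc-≡ j+k+1≡m)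

  adjacentFrom-isReflection : ∀ j k (j+k≡m : j + k ≡ m) → All IsReflection (adjacentFrom j k j+k≡m)
  adjacentFrom-isReflection j zero _ = []
  adjacentFrom-isReflection j (suc k) e =
    adjacent-isReflection (+-suc-≡⇒< e) ∷ adjacentFrom-isReflection (suc j) k (+-suc-≡ e)

  isCycleFrom-adjacentFrom : ∀ j k (j+k≡m : j + k ≡ m) → IsCycleFrom j (prodV (adjacentFrom j k j+k≡m))
  isCycleFrom-adjacentFrom j zero e = subst (λ j → IsCycleFrom j idP) (sym (trans (sym (+-identityʳ j)) e)) isCycleFrom-id
  isCycleFrom-adjacentFrom j (suc k) e =
    isCycleFrom-adjacent (+-suc-≡⇒< e) (isCycleFrom-adjacentFrom (suc j) k (+-suc-≡ e))

-- Reflection length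

sum-mono-≤ : ∀ {m} {f g : Fin m → ℕ} → (∀ i → f i ≤ g i) → sum f ≤ sum g
sum-mono-≤ {zero} f≤g = z≤n
sum-mono-≤ {suc m} f≤g = +-mono-≤ (f≤g fzero) (sum-mono-≤ (f≤g ∘ fsuc))

sum-≤-except : ∀ {m} {f g : Fin m → ℕ} (j : Fin m) → (∀ i → i ≢ j → f i ≤ g i) → f j ≤ suc (g j) →
               sum f ≤ suc (sum g)
sum-≤-except fzero f≤g fj≤ = +-mono-≤ fj≤ (sum-mono-≤ (λ i → f≤g (fsuc i) (λ ())))
sum-≤-except {g = g} (fsuc j) f≤g fj≤ =
  ≤-trans (+-mono-≤ (f≤g fzero (λ ())) (sum-≤-except j (λ i i≢j → f≤g (fsuc i) (i≢j ∘ fsuc-injective)) fj≤))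
          (≤-reflexive (+-suc (g fzero) (sum (g ∘ fsuc))))

sum-const : ∀ m k → sum {m} (λ _ → k) ≡ m * k
sum-const zero k = refl
sum-const (suc m) k = cong (k +_) (sum-const m k)

module _ {n : ℕ} where

  fixedAt : (SE n → SE n) → SE n → ℕ
  fixedAt L x with L x ≟SE x
  ... | yes _ = 1
  ... | no _ = 0

  fixedPoints : (SE n → SE n) → ℕ
  fixedPoints L = ∑[ i < n ] (fixedAt L (false , i) + fixedAt L (true , i))

  fixedAt-≤1 : ∀ L x → fixedAt L x ≤ 1
  fixedAt-≤1 L x with L x ≟SE x
  ... | yes _ = s≤s z≤n
  ... | no _ = z≤n

  fixedAt-mono : ∀ L M x → (L x ≡ x → M x ≡ x) → fixedAt L x ≤ fixedAt M x
  fixedAt-mono L M x fix with L x ≟SE x | M x ≟SE x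
  ... | yes _ | yes _ = ≤-refl
  ... | yes Lx≡x | no Mx≢x = ⊥-elim (Mx≢x (fix Lx≡x))
  ... | no _ | _ = z≤n

  fixedAt-id : ∀ x → fixedAt id x ≡ 1
  fixedAt-id x with x ≟SE x
  ... | yes _ = refl
  ... | no x≢x = ⊥-elim (x≢x refl)

  fixedPoints-id : fixedPoints id ≡ n * 2
  fixedPoints-id =
    trans (sum-cong-≗ (λ i → cong₂ _+_ (fixedAt-id (false , i)) (fixedAt-id (true , i)))) (sum-const n 2)

  fixedPoints-≤-except : ∀ {L M} (y : SE n) → (∀ x → x ≢ y → fixedAt L x ≤ fixedAt M x) →
                         fixedPoints L ≤ suc (fixedPoints M)
  fixedPoints-≤-except {L} {M} (b , j) L≤M = sum-≤-except j
    (λ i i≢j → +-mono-≤ (L≤M (false , i) (i≢j ∘ cong proj₂)) (L≤M (true , i) (i≢j ∘ cong proj₂)))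
    (at b L≤M)
    where
    at : ∀ b → (∀ x → x ≢ (b , j) → fixedAt L x ≤ fixedAt M x) →
         fixedAt L (false , j) + fixedAt L (true , j) ≤ suc (fixedAt M (false , j) + fixedAt M (true , j))
    at false L≤M = +-mono-≤ (fixedAt-≤1 L _) (≤-trans (L≤M (true , j) (λ ())) (m≤n+m _ _))
    at true L≤M = ≤-trans (+-mono-≤ (L≤M (false , j) (λ ())) (fixedAt-≤1 L _))
                          (≤-trans (≤-reflexive (+-comm _ 1)) (s≤s (m≤m+n _ _)))

  fixedAt-unfixed : ∀ L x → L x ≢ x → fixedAt L x ≡ 0
  fixedAt-unfixed L x Lx≢x with L x ≟SE x
  ... | yes Lx≡x = ⊥-elim (Lx≢x Lx≡x)
  ... | no _ = refl

  fixedPoints-neg : fixedPoints neg ≡ 0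
  fixedPoints-neg = trans (sum-cong-≗ (λ i → cong₂ _+_ (fixedAt-unfixed neg (false , i) (neg-≢ _))
                                                         (fixedAt-unfixed neg (true , i) (neg-≢ _))))
                          (sum-replicate-zero n)

  fixedPoints-const : ∀ L z → (∀ x → L x ≡ z) → fixedPoints L ≤ 1
  fixedPoints-const L z L≡z = ≤-trans
    (fixedPoints-≤-except {L} {neg} z λ x x≢z →
       fixedAt-mono L neg x (λ Lx≡x → ⊥-elim (x≢z (trans (sym Lx≡x) (L≡z x)))))
    (≤-reflexive (cong suc fixedPoints-neg))

  identify : SE n → SE n → SE n → SE n
  identify u v z with z ≟SE v
  ... | yes _ = u
  ... | no _ = z

  identify-other : ∀ u v z → z ≢ v → identify u v z ≡ z
  identify-other u v z z≢v with z ≟SE v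
  ... | yes z≡v = ⊥-elim (z≢v z≡v)
  ... | no _ = refl

  identify-same : ∀ u v → identify u v u ≡ identify u v v
  identify-same u v with u ≟SE v | v ≟SE v
  ... | yes _ | yes _ = refl
  ... | no _ | yes _ = refl
  ... | _ | no v≢v = ⊥-elim (v≢v refl)

  merge : (SE n → SE n) → SE n → SE n → SE n → SE n
  merge L a b = identify (L a) (L b) ∘ L

  merge-identifies : ∀ L a b → merge L a b a ≡ merge L a b b
  merge-identifies L a b = identify-same (L a) (L b)

  fixedPoints-merge : ∀ L a b → fixedPoints L ≤ suc (fixedPoints (merge L a b))
  fixedPoints-merge L a b = fixedPoints-≤-except (L b) (λ x x≢Lb → fixedAt-mono L (merge L a b) x
    (λ Lx≡x → trans (cong (identify (L a) (L b)) Lx≡x) (identify-other (L a) (L b) x x≢Lb)))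

  reflection-coarsening : ∀ {t} → IsReflection t → (L : SE n → SE n) →
    Σ (SE n → SE n) λ F → (∀ x → F (L (fun t x)) ≡ F (L x)) × fixedPoints L ≤ 2 + fixedPoints (F ∘ L)
  reflection-coarsening (inj₁ (i , j , _ , t≡swaps)) L =
    identify (M₁ a⁻) (M₁ (neg j)) ∘ identify (L a) (L j) ,
    (λ x → trans (cong M₂ (t≡swaps x))
           (trans (swap-invariant M₂ a j (cong (identify (M₁ a⁻) (M₁ (neg j))) (merge-identifies L a j)) _)
                  (swap-invariant M₂ a⁻ (neg j) (merge-identifies M₁ a⁻ (neg j)) x))) ,
    ≤-trans (fixedPoints-merge L a j) (s≤s (fixedPoints-merge M₁ a⁻ (neg j)))
    where
    a a⁻ : SE n
    a = (false , i)
    a⁻ = (true , i)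
    M₁ M₂ : SE n → SE n
    M₁ = merge L a j
    M₂ = merge M₁ a⁻ (neg j)
  reflection-coarsening (inj₂ (i , t≡swap)) L =
    identify (L (false , i)) (L (true , i)) ,
    (λ x → trans (cong M (t≡swap x)) (swap-invariant M _ _ (merge-identifies L (false , i) (true , i)) x)) ,
    ≤-trans (fixedPoints-merge L (false , i) (true , i)) (n≤1+n _)
    where
    M : SE n → SE n
    M = merge L (false , i) (true , i)

  invariantLabelling : ∀ {k} (ts : Vec (SPerm n) k) → All IsReflection ts →
    Σ (SE n → SE n) λ L → (∀ x → L (fun (prodV ts) x) ≡ L x) × n * 2 ≤ fixedPoints L + k * 2
  invariantLabelling [] [] = id , (λ _ → refl) , ≤-reflexive (sym (trans (+-identityʳ _) fixedPoints-id))
  invariantLabelling {suc k} (t ∷ ts) (t-refl ∷ ts-refl) with invariantLabelling ts ts-refl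
  ... | L , L-inv , bound with reflection-coarsening {t} t-refl L
  ...   | F , F-inv , coarse =
    F ∘ L , (λ x → trans (F-inv _) (cong F (L-inv x))) ,
    ≤-trans bound (≤-trans (+-monoˡ-≤ (k * 2) coarse) 
      (≤-reflexive (trans (cong (_+ k * 2) (+-comm 2 _)) (+-assoc (fixedPoints (F ∘ L)) 2 (k * 2)))))

-- The Coxeter element

module _ {A : Set} (f : A → A) where
  open import Function.Endo.Propositional A using (_^_; ^-homo)

  ^-+ : ∀ a b x → (f ^ (a + b)) x ≡ (f ^ a) ((f ^ b) x)
  ^-+ a b x = cong-app (^-homo f a b) x

  ^-commute : ∀ {g : A → A} → (∀ x → f (g x) ≡ g (f x)) → ∀ a x → (f ^ a) (g x) ≡ g ((f ^ a) x)
  ^-commute f∘g zero x = refl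
  ^-commute f∘g (suc a) x = trans (cong f (^-commute f∘g a x)) (f∘g _)

  ^-inverse : ∀ {g : A → A} → (∀ x → f (g x) ≡ x) → (∀ x → g (f x) ≡ x) →
              ∀ a x → (f ^ a) ((g ^ a) x) ≡ x
  ^-inverse f∘g g∘f zero x = refl
  ^-inverse {g} f∘g g∘f (suc a) x = begin
    f ((f ^ a) (g ((g ^ a) x))) ≡⟨ cong f (^-commute (λ y → trans (f∘g y) (sym (g∘f y))) a _) ⟩
    f (g ((f ^ a) ((g ^ a) x))) ≡⟨ f∘g _ ⟩
    (f ^ a) ((g ^ a) x)         ≡⟨ ^-inverse f∘g g∘f a x ⟩
    x                           ∎
    where open ≡-Reasoning

  ^-invariant : ∀ {B : Set} (L : A → B) → (∀ x → L (f x) ≡ L x) → ∀ a x → L ((f ^ a) x) ≡ L x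
  ^-invariant L L-inv zero x = refl
  ^-invariant L L-inv (suc a) x = trans (L-inv _) (^-invariant L L-inv a x)

cfun-< : ∀ {m} b (i : Fin (suc m)) (q : suc (toℕ i) < suc m) → cfun (b , i) ≡ (b , fromℕ< q)
cfun-< {m} b i q with suc (toℕ i) <? suc m
... | yes _ = refl
... | no ¬q = ⊥-elim (¬q q)

cfun-last : ∀ {m} b (i : Fin (suc m)) → suc (toℕ i) ≡ suc m → cfun (b , i) ≡ (not b , fzero)
cfun-last {m} b i i-last with suc (toℕ i) <? suc m
... | yes q = ⊥-elim (<-irrefl i-last q)
... | no _ = refl

module CoxeterElement {m : ℕ} (c : SPerm (suc m)) (cox : IsCoxC c) where
  open import Function.Endo.Propositional (SE (suc m)) using (_^_)

  N : ℕ
  N = suc m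

  c^-from-zero : ∀ b d (d<N : d < N) → (fun c ^ d) (b , fzero) ≡ (b , fromℕ< d<N)
  c^-from-zero b zero d<N = refl
  c^-from-zero b (suc d) d+1<N = begin
    fun c ((fun c ^ d) (b , fzero)) ≡⟨ cong (fun c) (c^-from-zero b d d<N) ⟩
    fun c (b , fromℕ< d<N)          ≡⟨ cox _ ⟩
    cfun (b , fromℕ< d<N)           ≡⟨ cfun-< b _ q ⟩
    (b , fromℕ< q)                  ≡⟨ cong (b ,_) (fromℕ<-cong _ _ (cong suc (toℕ-fromℕ< d<N)) q d+1<N) ⟩
    (b , fromℕ< d+1<N)              ∎
    where
    open ≡-Reasoning
    d<N : d < N
    d<N = <-trans (n<1+n d) d+1<N
    q : suc (toℕ (fromℕ< d<N)) < N
    q = subst (λ k → suc k < N) (sym (toℕ-fromℕ< d<N)) d+1<N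

  c^-toℕ : ∀ b (i : Fin N) → (fun c ^ toℕ i) (b , fzero) ≡ (b , i)
  c^-toℕ b i = trans (c^-from-zero b (toℕ i) (toℕ<n i)) (cong (b ,_) (fromℕ<-toℕ i (toℕ<n i)))

  c^N-zero : ∀ b → (fun c ^ N) (b , fzero) ≡ (not b , fzero)
  c^N-zero b = begin
    fun c ((fun c ^ m) (b , fzero)) ≡⟨ cong (fun c) (c^-from-zero b m (n<1+n m)) ⟩
    fun c (b , fromℕ< (n<1+n m))    ≡⟨ cox _ ⟩
    cfun (b , fromℕ< (n<1+n m))     ≡⟨ cfun-last b _ (cong suc (toℕ-fromℕ< (n<1+n m))) ⟩
    (not b , fzero)                 ∎
    where open ≡-Reasoning

  c^N : ∀ x → (fun c ^ N) x ≡ neg x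
  c^N (b , i) = begin
    (fun c ^ N) (b , i)                          ≡⟨ cong (fun c ^ N) (sym (c^-toℕ b i)) ⟩
    (fun c ^ N) ((fun c ^ toℕ i) (b , fzero))    ≡⟨ sym (^-+ (fun c) N (toℕ i) _) ⟩
    (fun c ^ (N + toℕ i)) (b , fzero)            ≡⟨ cong (λ k → (fun c ^ k) (b , fzero)) (+-comm N (toℕ i)) ⟩
    (fun c ^ (toℕ i + N)) (b , fzero)            ≡⟨ ^-+ (fun c) (toℕ i) N _ ⟩
    (fun c ^ toℕ i) ((fun c ^ N) (b , fzero))    ≡⟨ cong (fun c ^ toℕ i) (c^N-zero b) ⟩
    (fun c ^ toℕ i) (not b , fzero)              ≡⟨ c^-toℕ (not b) i ⟩
    (not b , i)                                  ∎
    where open ≡-Reasoning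

  c-invariant-constant : ∀ {B : Set} (L : SE N → B) → (∀ x → L (fun c x) ≡ L x) →
                         ∀ x → L x ≡ L (false , fzero)
  c-invariant-constant L L-inv (b , i) =
    trans (sym (cong L (c^-toℕ b i))) (trans (^-invariant (fun c) L L-inv (toℕ i) _) (at-zero b))
    where
    at-zero : ∀ b → L (b , fzero) ≡ L (false , fzero)
    at-zero false = refl
    at-zero true = trans (sym (cong L (c^N-zero false))) (^-invariant (fun c) L L-inv N _)

  ¬ProdOf-c : ∀ k → k < N → ¬ ProdOf k c
  ¬ProdOf-c k k<N (ts , ts-refl , ts≈c) with invariantLabelling ts ts-refl
  ... | L , L-inv , bound =
    <-irrefl refl (≤-trans (*-monoˡ-≤ 2 k<N) (≤-trans bound (+-monoˡ-≤ (k * 2) single-class)))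
    where
    single-class : fixedPoints L ≤ 1
    single-class = fixedPoints-const L _ (c-invariant-constant L (λ x → trans (cong L (sym (ts≈c x))) (L-inv x)))

  position : (i : Fin N) → (suc (toℕ i) < N) ⊎ (toℕ i ≡ m)
  position i with suc (toℕ i) <? N
  ... | yes q = inj₁ q
  ... | no ¬q = inj₂ (≤-antisym (s≤s⁻¹ (toℕ<n i)) (s≤s⁻¹ (≮⇒≥ ¬q)))

  -- σ = (1 2 … n)(−1 −2 … −n) is c without its sign change.
  σ : SPerm N
  σ = prodV (adjacentFrom 0 m refl)

  σ-cycle : IsCycleFrom 0 σ
  σ-cycle = isCycleFrom-adjacentFrom 0 m refl

  σ-ProdOf : ProdOf m σ
  σ-ProdOf = adjacentFrom 0 m refl , adjacentFrom-isReflection 0 m refl , λ _ → refl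

  flip·σ≈c : (flipAt fzero · σ) ≈ c
  flip·σ≈c (b , i) with position i
  ... | inj₁ q = begin
    fun (flipAt fzero) (fun σ (b , i)) ≡⟨ cong (fun (flipAt fzero)) (IsCycleFrom.shifts σ-cycle b i z≤n q) ⟩
    fun (flipAt fzero) (b , fromℕ< q)  ≡⟨ flipAt-other b (λ e → 0≢1+n (trans (cong toℕ (sym e)) (toℕ-fromℕ< q))) ⟩
    (b , fromℕ< q)                     ≡⟨ sym (trans (cox _) (cfun-< b i q)) ⟩
    fun c (b , i)                      ∎
    where open ≡-Reasoning
  ... | inj₂ i≡m = begin
    fun (flipAt fzero) (fun σ (b , i)) ≡⟨ cong (fun (flipAt fzero)) (IsCycleFrom.wraps σ-cycle b i i≡m z<s) ⟩
    fun (flipAt fzero) (b , fzero)     ≡⟨ flipAt-same b fzero ⟩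
    (not b , fzero)                    ≡⟨ sym (trans (cox _) (cfun-last b i (cong suc i≡m))) ⟩
    fun c (b , i)                      ∎
    where open ≡-Reasoning

  σ·flip≈c : (σ · flipAt (fromℕ m)) ≈ c
  σ·flip≈c (b , i) with position i
  ... | inj₁ q = begin
    fun σ (fun (flipAt (fromℕ m)) (b , i)) ≡⟨ cong (fun σ) (flipAt-other b i≢last) ⟩
    fun σ (b , i)                          ≡⟨ IsCycleFrom.shifts σ-cycle b i z≤n q ⟩
    (b , fromℕ< q)                         ≡⟨ sym (trans (cox _) (cfun-< b i q)) ⟩
    fun c (b , i)                          ∎
    where
    open ≡-Reasoning
    i≢last : i ≢ fromℕ m
    i≢last e = <⇒≢ (s<s⁻¹ q) (trans (cong toℕ e) (toℕ-fromℕ m))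
  ... | inj₂ i≡m = begin
    fun σ (fun (flipAt (fromℕ m)) (b , i)) ≡⟨ cong (λ k → fun σ (fun (flipAt (fromℕ m)) (b , k))) i≡last ⟩
    fun σ (fun (flipAt (fromℕ m)) (b , fromℕ m)) ≡⟨ cong (fun σ) (flipAt-same b (fromℕ m)) ⟩
    fun σ (not b , fromℕ m)                ≡⟨ IsCycleFrom.wraps σ-cycle (not b) (fromℕ m) (toℕ-fromℕ m) z<s ⟩
    (not b , fzero)                        ≡⟨ sym (trans (cox _) (cfun-last b i (cong suc i≡m))) ⟩
    fun c (b , i)                          ∎
    where
    open ≡-Reasoning
    i≡last : i ≡ fromℕ m
    i≡last = toℕ-injective (trans i≡m (sym (toℕ-fromℕ m)))

-- The dihedral group ⟨φ_l, φ_r⟩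

module _ {n : ℕ} where

  inv-involution : (A : SPerm n) → (A · A) ≈ idP → ∀ z → inv A z ≡ fun A z
  inv-involution A A·A≈id z = trans (sym (A·A≈id (inv A z))) (cong (fun A) (fun∘inv A z))

  inv-cong : (A B : SPerm n) → A ≈ B → ∀ z → inv A z ≡ inv B z
  inv-cong A B A≈B z =
    trans (sym (inv∘fun B (inv A z))) (cong (inv B) (trans (sym (A≈B (inv A z))) (fun∘inv A z)))

  φ-cong : (x A B : SPerm n) → A ≈ B → φ x A ≈ φ x B
  φ-cong x A B A≈B y = cong (fun x) (inv-cong A B A≈B (fun x y))

  φ-involutive : (x A : SPerm n) → φ x (φ x A) ≈ A
  φ-involutive x A y = trans (fun∘inv x _) (cong (fun A) (inv∘fun x y))

  SameOnNC-φˡ-cancel : (c l r : SPerm n) (u v : List Bool) →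
                       SameOnNC c l r (true ∷ u) (true ∷ v) → SameOnNC c l r u v
  SameOnNC-φˡ-cancel c l r u v same w w∈NC y = begin
    fun U y                ≡⟨ sym (φ-involutive l U y) ⟩
    fun (φ l (φ l U)) y    ≡⟨ φ-cong l (φ l U) (φ l V) (same w w∈NC) y ⟩
    fun (φ l (φ l V)) y    ≡⟨ φ-involutive l V y ⟩
    fun V y                ∎
    where
    open ≡-Reasoning
    U V : SPerm n
    U = evalWord l r u w
    V = evalWord l r v w

rotationWord : ℕ → List Bool
rotationWord zero = []
rotationWord (suc a) = false ∷ true ∷ rotationWord a

normalWord : Fin 2 → ℕ → List Bool
normalWord fzero a = rotationWord a
normalWord (fsuc fzero) a = true ∷ rotationWord a

module DihedralGroup {k : ℕ} (c l r : SPerm (suc (suc k))) (cox : IsCoxC c) (bip : Bipartition c l r) where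
  open CoxeterElement c cox
  open import Function.Endo.Propositional (SE N) using (_^_)
  open ≡-Reasoning

  ev : List Bool → SPerm N → SPerm N
  ev = evalWord l r

  Same : List Bool → List Bool → Set
  Same = SameOnNC c l r

  l∘l : ∀ z → fun l (fun l z) ≡ z
  l∘l = proj₁ bip

  r∘r : ∀ z → fun r (fun r z) ≡ z
  r∘r = proj₁ (proj₂ bip)

  l∘r : ∀ z → fun l (fun r z) ≡ fun c z
  l∘r = proj₂ (proj₂ bip)

  r∘l : ∀ z → fun r (fun l z) ≡ inv c z
  r∘l z = trans (sym (inv∘fun c _)) (cong (inv c) (trans (sym (l∘r _)) (trans (cong (fun l) (r∘r _)) (l∘l z))))

  l∘c : ∀ z → fun l (fun c z) ≡ inv c (fun l z)
  l∘c z = trans (cong (fun l) (sym (l∘r z))) (trans (l∘l _) (trans (cong (fun r) (sym (l∘l z))) (r∘l _)))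

  c^∘c⁻^ : ∀ a x → (fun c ^ a) ((inv c ^ a) x) ≡ x
  c^∘c⁻^ = ^-inverse (fun c) (fun∘inv c) (inv∘fun c)

  c⁻^∘c^ : ∀ a x → (inv c ^ a) ((fun c ^ a) x) ≡ x
  c⁻^∘c^ = ^-inverse (inv c) (inv∘fun c) (fun∘inv c)

  c⁻^-odd : ∀ a x → (inv c ^ a) (neg x) ≡ neg ((inv c ^ a) x)
  c⁻^-odd = ^-commute (inv c) (odd (c ⁻¹))

  c⁻^N : ∀ z → (inv c ^ N) z ≡ neg z
  c⁻^N z = begin
    (inv c ^ N) z                        ≡⟨ cong (inv c ^ N) (sym (trans (c^N (neg z)) (neg-involutive z))) ⟩
    (inv c ^ N) ((fun c ^ N) (neg z))    ≡⟨ c⁻^∘c^ N (neg z) ⟩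
    neg z                                ∎

  rotation-action : ∀ a w y → fun (ev (rotationWord a) w) y ≡ (inv c ^ a) (fun w ((fun c ^ a) y))
  rotation-action zero w y = refl
  rotation-action (suc a) w y = begin
    fun r (inv l (fun X (inv l (fun r y))))              ≡⟨ cong (λ z → fun r (inv l (fun X z))) l⁻¹∘r≡c ⟩
    fun r (inv l (fun X (fun c y)))                      ≡⟨ trans (cong (fun r) (inv-l _)) (r∘l _) ⟩
    inv c (fun X (fun c y))                              ≡⟨ cong (inv c) (rotation-action a w (fun c y)) ⟩
    inv c ((inv c ^ a) (fun w ((fun c ^ a) (fun c y)))) ≡⟨ cong (λ z → inv c ((inv c ^ a) (fun w z))) c^a∘c ⟩
    inv c ((inv c ^ a) (fun w (fun c ((fun c ^ a) y)))) ∎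
    where
    X : SPerm N
    X = ev (rotationWord a) w
    inv-l : ∀ z → inv l z ≡ fun l z
    inv-l = inv-involution l l∘l
    l⁻¹∘r≡c : inv l (fun r y) ≡ fun c y
    l⁻¹∘r≡c = trans (inv-l _) (l∘r y)
    c^a∘c : (fun c ^ a) (fun c y) ≡ fun c ((fun c ^ a) y)
    c^a∘c = ^-commute (fun c) {fun c} (λ _ → refl) a y

  rotation-N : ∀ w → ev (rotationWord N) w ≈ w
  rotation-N w y = begin
    fun (ev (rotationWord N) w) y        ≡⟨ rotation-action N w y ⟩
    (inv c ^ N) (fun w ((fun c ^ N) y))  ≡⟨ cong (λ z → (inv c ^ N) (fun w z)) (c^N y) ⟩
    (inv c ^ N) (fun w (neg y))          ≡⟨ c⁻^N _ ⟩
    neg (fun w (neg y))                  ≡⟨ cong neg (odd w y) ⟩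
    neg (neg (fun w y))                  ≡⟨ neg-involutive _ ⟩
    fun w y                              ∎

  NormalForm : List Bool → Set
  NormalForm v = Σ (Fin 2) λ s → Σ ℕ λ j → j < N × (∀ w → ev v w ≈ ev (normalWord s j) w)

  normalForm : ∀ v → NormalForm v
  normalForm [] = fzero , 0 , z<s , λ _ _ → refl
  normalForm (true ∷ v) with normalForm v
  ... | fzero , j , j<N , v≈ =
    fsuc fzero , j , j<N , λ w → φ-cong l (ev v w) (ev (rotationWord j) w) (v≈ w)
  ... | fsuc fzero , j , j<N , v≈ = fzero , j , j<N , λ w y →
    trans (φ-cong l (ev v w) (ev (true ∷ rotationWord j) w) (v≈ w) y) (φ-involutive l (ev (rotationWord j) w) y)
  normalForm (false ∷ v) with normalForm v
  ... | fzero , suc j , j+1<N , v≈ = fsuc fzero , j , <-trans (n<1+n j) j+1<N , λ w y →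
    trans (φ-cong r (ev v w) (ev (rotationWord (suc j)) w) (v≈ w) y)
          (φ-involutive r (ev (true ∷ rotationWord j) w) y)
  ... | fzero , zero , _ , v≈ = fsuc fzero , suc k , n<1+n (suc k) , λ w y → begin
    fun (φ r (ev v w)) y                        ≡⟨ φ-cong r (ev v w) w (v≈ w) y ⟩
    fun (φ r w) y                               ≡⟨ φ-cong r w (ev (rotationWord N) w) (sym ∘ rotation-N w) y ⟩
    fun (φ r (ev (rotationWord N) w)) y         ≡⟨ φ-involutive r (ev (true ∷ rotationWord (suc k)) w) y ⟩
    fun (ev (true ∷ rotationWord (suc k)) w) y  ∎
  ... | fsuc fzero , j , j<N , v≈ with suc j <? N
  ...   | yes j+1<N = fzero , suc j , j+1<N , λ w → φ-cong r (ev v w) (ev (true ∷ rotationWord j) w) (v≈ w)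
  ...   | no j+1≮N = fzero , 0 , z<s , λ w y → begin
    fun (φ r (ev v w)) y                ≡⟨ φ-cong r (ev v w) (ev (true ∷ rotationWord j) w) (v≈ w) y ⟩
    fun (ev (rotationWord (suc j)) w) y ≡⟨ cong (λ a → fun (ev (rotationWord a) w) y) j+1≡N ⟩
    fun (ev (rotationWord N) w) y       ≡⟨ rotation-N w y ⟩
    fun w y                             ∎
    where
    j+1≡N : suc j ≡ N
    j+1≡N = ≤-antisym j<N (≮⇒≥ j+1≮N)

  e₁ : SE N
  e₁ = (false , fzero)

  t₁ s₁ : SPerm N
  t₁ = flipAt fzero
  s₁ = transposeAt fzero (fsuc fzero)

  t₁∈NC : InNC c t₁
  t₁∈NC = reducedPrefix-≤T {u = t₁} {σ} {c} (ProdOf-reflection {t = t₁} (flipAt-isReflection fzero))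
                           σ-ProdOf flip·σ≈c ¬ProdOf-c

  s₁∈NC : InNC c s₁
  s₁∈NC = reducedPrefix-≤T {u = s₁} {prodV rest · t-last} {c}
    (ProdOf-reflection {t = s₁} (adjacent-isReflection z<s))
    (ProdOf-· {u = prodV rest} {t-last} (rest , adjacentFrom-isReflection 1 k refl , λ _ → refl)
                                        (ProdOf-reflection {t = t-last} (flipAt-isReflection _)))
    σ·flip≈c
    (λ m m<1+k+1 → ¬ProdOf-c m (subst (m <_) (cong suc (+-comm k 1)) m<1+k+1))
    where
    rest : Vec (SPerm N) k
    rest = adjacentFrom 1 k refl
    t-last : SPerm N
    t-last = flipAt (fromℕ (suc k))

  rotation-t₁-negates : ∀ a → fun (ev (rotationWord a) t₁) ((inv c ^ a) e₁) ≡ neg ((inv c ^ a) e₁)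
  rotation-t₁-negates a = begin
    fun (ev (rotationWord a) t₁) ((inv c ^ a) e₁)       ≡⟨ rotation-action a t₁ _ ⟩
    (inv c ^ a) (fun t₁ ((fun c ^ a) ((inv c ^ a) e₁))) ≡⟨ cong (λ z → (inv c ^ a) (fun t₁ z)) (c^∘c⁻^ a e₁) ⟩
    (inv c ^ a) (fun t₁ e₁)                             ≡⟨ cong (inv c ^ a) (flipAt-same false fzero) ⟩
    (inv c ^ a) (neg e₁)                                ≡⟨ c⁻^-odd a e₁ ⟩
    neg ((inv c ^ a) e₁)                                ∎

  rotation-t₁-fixes : ∀ a d → 0 < d → d + a < N →
                      fun (ev (rotationWord (d + a)) t₁) ((inv c ^ a) e₁) ≡ (inv c ^ a) e₁
  rotation-t₁-fixes a d 0<d d+a<N = begin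
    fun (ev (rotationWord (d + a)) t₁) ((inv c ^ a) e₁)             ≡⟨ rotation-action (d + a) t₁ _ ⟩
    (inv c ^ (d + a)) (fun t₁ ((fun c ^ (d + a)) ((inv c ^ a) e₁))) ≡⟨ cong ((inv c ^ (d + a)) ∘ fun t₁) c^d+a ⟩
    (inv c ^ (d + a)) (fun t₁ ((fun c ^ d) e₁))                     ≡⟨ cong (inv c ^ (d + a)) t₁-fixes ⟩
    (inv c ^ (d + a)) ((fun c ^ d) e₁)                              ≡⟨ cong (λ b → (inv c ^ b) c^d-e₁) (+-comm d a) ⟩
    (inv c ^ (a + d)) ((fun c ^ d) e₁)                              ≡⟨ ^-+ (inv c) a d _ ⟩
    (inv c ^ a) ((inv c ^ d) ((fun c ^ d) e₁))                      ≡⟨ cong (inv c ^ a) (c⁻^∘c^ d e₁) ⟩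
    (inv c ^ a) e₁                                                  ∎
    where
    d<N : d < N
    d<N = ≤-trans (s≤s (m≤m+n d a)) d+a<N
    c^d-e₁ : SE N
    c^d-e₁ = (fun c ^ d) e₁
    c^d+a : (fun c ^ (d + a)) ((inv c ^ a) e₁) ≡ (fun c ^ d) e₁
    c^d+a = trans (^-+ (fun c) d a _) (cong (fun c ^ d) (c^∘c⁻^ a e₁))
    t₁-fixes : fun t₁ ((fun c ^ d) e₁) ≡ (fun c ^ d) e₁
    t₁-fixes = trans (cong (fun t₁) (c^-from-zero false d d<N))
      (trans (flipAt-other false (λ e → <⇒≢ 0<d (sym (trans (sym (toℕ-fromℕ< d<N)) (cong toℕ e)))))
             (sym (c^-from-zero false d d<N)))

  rotation-t₁-< : ∀ {a b} → a < b → b < N → ¬ (ev (rotationWord a) t₁ ≈ ev (rotationWord b) t₁)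
  rotation-t₁-< {a} {b} a<b b<N same = neg-≢ x (begin
    neg x                                    ≡⟨ sym (rotation-t₁-negates a) ⟩
    fun (ev (rotationWord a) t₁) x           ≡⟨ same x ⟩
    fun (ev (rotationWord b) t₁) x           ≡⟨ cong (λ b → fun (ev (rotationWord b) t₁) x) (sym b-a+a≡b) ⟩
    fun (ev (rotationWord (b ∸ a + a)) t₁) x ≡⟨ rotation-t₁-fixes a (b ∸ a) (m<n⇒0<n∸m a<b) b-a+a<N ⟩
    x                                        ∎)
    where
    x : SE N
    x = (inv c ^ a) e₁
    b-a+a≡b : b ∸ a + a ≡ b
    b-a+a≡b = m∸n+n≡m (<⇒≤ a<b)
    b-a+a<N : b ∸ a + a < N
    b-a+a<N = subst (_< N) (sym b-a+a≡b) b<N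

  rotation-t₁-injective : ∀ {a b} → a < N → b < N → ev (rotationWord a) t₁ ≈ ev (rotationWord b) t₁ → a ≡ b
  rotation-t₁-injective {a} {b} a<N b<N same with <-cmp a b
  ... | tri< a<b _ _ = ⊥-elim (rotation-t₁-< a<b b<N same)
  ... | tri≈ _ a≡b _ = a≡b
  ... | tri> _ _ b<a = ⊥-elim (rotation-t₁-< b<a a<N (sym ∘ same))

  twist : ℕ → ℕ → SE N → SE N
  twist a b x = (fun c ^ a) (fun l ((inv c ^ b) x))

  twist-c : ∀ a b x → twist a b (fun c x) ≡ inv c (twist a b x)
  twist-c a b x = begin
    (fun c ^ a) (fun l ((inv c ^ b) (fun c x)))  ≡⟨ cong (λ z → (fun c ^ a) (fun l z)) (^-commute (inv c) c⁻∘c b x) ⟩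
    (fun c ^ a) (fun l (fun c ((inv c ^ b) x)))  ≡⟨ cong (fun c ^ a) (l∘c _) ⟩
    (fun c ^ a) (inv c (fun l ((inv c ^ b) x)))  ≡⟨ ^-commute (fun c) (sym ∘ c⁻∘c) a _ ⟩
    inv c (twist a b x)                          ∎
    where
    c⁻∘c : ∀ z → inv c (fun c z) ≡ fun c (inv c z)
    c⁻∘c z = trans (inv∘fun c z) (sym (fun∘inv c z))

  twist-odd : ∀ a b x → twist a b (neg x) ≡ neg (twist a b x)
  twist-odd a b x = begin
    (fun c ^ a) (fun l ((inv c ^ b) (neg x)))    ≡⟨ cong (λ z → (fun c ^ a) (fun l z)) (c⁻^-odd b x) ⟩
    (fun c ^ a) (fun l (neg ((inv c ^ b) x)))    ≡⟨ cong (fun c ^ a) (odd l _) ⟩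
    (fun c ^ a) (neg (fun l ((inv c ^ b) x)))    ≡⟨ ^-commute (fun c) (odd c) a _ ⟩
    neg (twist a b x)                            ∎

  rotation-involution : ∀ a t → (t · t) ≈ idP → (ev (rotationWord a) t · ev (rotationWord a) t) ≈ idP
  rotation-involution a t t·t≈id y = begin
    fun X (fun X y)                                      ≡⟨ rotation-action a t _ ⟩
    (inv c ^ a) (fun t ((fun c ^ a) (fun X y)))          ≡⟨ cong (λ z → (inv c ^ a) (fun t z)) c^a∘X ⟩
    (inv c ^ a) (fun t (fun t ((fun c ^ a) y)))          ≡⟨ cong (inv c ^ a) (t·t≈id _) ⟩
    (inv c ^ a) ((fun c ^ a) y)                          ≡⟨ c⁻^∘c^ a y ⟩
    y                                                    ∎
    where
    X : SPerm N
    X = ev (rotationWord a) t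
    c^a∘X : (fun c ^ a) (fun X y) ≡ fun t ((fun c ^ a) y)
    c^a∘X = trans (cong (fun c ^ a) (rotation-action a t y)) (c^∘c⁻^ a _)

  twist-commutes : ∀ a b t → (t · t) ≈ idP → ev (rotationWord a) t ≈ ev (true ∷ rotationWord b) t →
                   ∀ x → fun t (twist a b x) ≡ twist a b (fun t x)
  twist-commutes a b t t·t≈id same x = begin
    fun t ((fun c ^ a) y)                                 ≡⟨ sym (c^∘c⁻^ a _) ⟩
    (fun c ^ a) ((inv c ^ a) (fun t ((fun c ^ a) y)))     ≡⟨ cong (fun c ^ a) (sym (rotation-action a t y)) ⟩
    (fun c ^ a) (fun (ev (rotationWord a) t) y)           ≡⟨ cong (fun c ^ a) (same y) ⟩
    (fun c ^ a) (fun l (inv X (fun l y)))                 ≡⟨ cong (λ z → (fun c ^ a) (fun l z)) X⁻¹≡X ⟩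
    (fun c ^ a) (fun l (fun X (fun l y)))                 ≡⟨ cong (λ z → (fun c ^ a) (fun l z)) X∘l∘y ⟩
    twist a b (fun t x)                                   ∎
    where
    X : SPerm N
    X = ev (rotationWord b) t
    y : SE N
    y = fun l ((inv c ^ b) x)
    X⁻¹≡X : inv X (fun l y) ≡ fun X (fun l y)
    X⁻¹≡X = inv-involution X (rotation-involution b t t·t≈id) _
    X∘l∘y : fun X (fun l y) ≡ (inv c ^ b) (fun t x)
    X∘l∘y = trans (rotation-action b t _)
      (cong (λ z → (inv c ^ b) (fun t z)) (trans (cong (fun c ^ b) (l∘l _)) (c^∘c⁻^ b x)))

  c-second≢first : ∀ b → fun c (b , fsuc fzero) ≢ (b , fzero)
  c-second≢first b c-e with position (fsuc fzero)
  ... | inj₁ q = 0≢1+n (trans (cong (toℕ ∘ proj₂) (sym (trans (sym (trans (cox _) (cfun-< b _ q))) c-e)))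
                              (toℕ-fromℕ< q))
  ... | inj₂ 1≡m = not-¬ refl (sym (cong proj₁ (trans (sym (trans (cox _) (cfun-last b _ (cong suc 1≡m)))) c-e)))

  no-twist : (W : SE N → SE N) → (∀ x → W (fun c x) ≡ inv c (W x)) → (∀ x → W (neg x) ≡ neg (W x)) →
             (∀ x → fun t₁ (W x) ≡ W (fun t₁ x)) → (∀ x → fun s₁ (W x) ≡ W (fun s₁ x)) → ⊥
  no-twist W W-c W-odd W-t₁ W-s₁ = c-second≢first b (begin
    fun c (b , fsuc fzero)      ≡⟨ cong (fun c) (sym (transposeAt-left b fzero (fsuc fzero))) ⟩
    fun c (fun s₁ (b , fzero))  ≡⟨ cong (λ z → fun c (fun s₁ z)) (sym W-e₁) ⟩
    fun c (fun s₁ (W e₁))       ≡⟨ cong (fun c) (W-s₁ e₁) ⟩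
    fun c (W (fun s₁ e₁))       ≡⟨ cong (λ z → fun c (W z)) s₁-e₁ ⟩
    fun c (W (fun c e₁))        ≡⟨ cong (fun c) (W-c e₁) ⟩
    fun c (inv c (W e₁))        ≡⟨ fun∘inv c _ ⟩
    W e₁                        ≡⟨ W-e₁ ⟩
    (b , fzero)                 ∎)
    where
    b : Bool
    b = proj₁ (W e₁)
    W-e₁ : W e₁ ≡ (b , fzero)
    W-e₁ = cong (b ,_) (flipAt-negates (trans (W-t₁ e₁) (W-odd e₁)))
    s₁-e₁ : fun s₁ e₁ ≡ fun c e₁
    s₁-e₁ = trans (transposeAt-left false fzero (fsuc fzero))
                  (sym (trans (cox _) (cfun-< false fzero (s≤s (s≤s z≤n)))))

  rotation≢reflection : ∀ a b → ¬ Same (rotationWord a) (true ∷ rotationWord b)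
  rotation≢reflection a b same = no-twist (twist a b) (twist-c a b) (twist-odd a b)
    (twist-commutes a b t₁ (fun∘inv t₁) (same t₁ t₁∈NC))
    (twist-commutes a b s₁ (fun∘inv s₁) (same s₁ s₁∈NC))

  wordAt : Fin 2 × Fin N → List Bool
  wordAt (s , j) = normalWord s (toℕ j)

  wordAt-distinct : ∀ p q → p ≢ q → ¬ Same (wordAt p) (wordAt q)
  wordAt-distinct (fzero , i) (fzero , j) p≢q same =
    p≢q (cong (fzero ,_) (toℕ-injective (rotation-t₁-injective (toℕ<n i) (toℕ<n j) (same t₁ t₁∈NC))))
  wordAt-distinct (fsuc fzero , i) (fsuc fzero , j) p≢q same =
    p≢q (cong (fsuc fzero ,_) (toℕ-injective (rotation-t₁-injective (toℕ<n i) (toℕ<n j) rotations-same)))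
    where
    rotations-same : ev (rotationWord (toℕ i)) t₁ ≈ ev (rotationWord (toℕ j)) t₁
    rotations-same = SameOnNC-φˡ-cancel c l r (rotationWord (toℕ i)) (rotationWord (toℕ j)) same t₁ t₁∈NC
  wordAt-distinct (fzero , i) (fsuc fzero , j) _ = rotation≢reflection (toℕ i) (toℕ j)
  wordAt-distinct (fsuc fzero , i) (fzero , j) _ same =
    rotation≢reflection (toℕ j) (toℕ i) (λ w w∈NC x → sym (same w w∈NC x))

  word : Fin (2 * N) → List Bool
  word = wordAt ∘ remQuot {2} N

  words : Vec (List Bool) (2 * N)
  words = tabulate word

  words-distinct : ∀ i j → i ≢ j → ¬ Same (lookup words i) (lookup words j)
  words-distinct i j i≢j rewrite lookup∘tabulate word i | lookup∘tabulate word j =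
    wordAt-distinct (remQuot {2} N i) (remQuot {2} N j) (λ e → i≢j (begin
      i                                   ≡⟨ sym (combine-remQuot {2} N i) ⟩
      uncurry combine (remQuot {2} N i)   ≡⟨ cong (uncurry combine) e ⟩
      uncurry combine (remQuot {2} N j)   ≡⟨ combine-remQuot {2} N j ⟩
      j                                   ∎))

  words-complete : ∀ v → Σ (Fin (2 * N)) λ i → Same v (lookup words i)
  words-complete v with normalForm v
  ... | s , j , j<N , v≈ = i , λ w _ x → begin
    fun (ev v w) x                ≡⟨ v≈ w x ⟩
    fun (ev (normalWord s j) w) x ≡⟨ cong (λ u → fun (ev u w) x) (sym word-i) ⟩
    fun (ev (lookup words i) w) x ∎
    where
    i : Fin (2 * N)
    i = combine s (fromℕ< j<N)
    word-i : lookup words i ≡ normalWord s j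
    word-i = begin
      lookup words i                  ≡⟨ lookup∘tabulate word i ⟩
      word i                          ≡⟨ cong wordAt (remQuot-combine {k = N} s (fromℕ< j<N)) ⟩
      normalWord s (toℕ (fromℕ< j<N)) ≡⟨ cong (normalWord s) (toℕ-fromℕ< j<N) ⟩
      normalWord s j                  ∎

mainTheorem13 : (n : ℕ) → 2 ≤ n → (c : SPerm n) → IsCoxC c →
    (l r : SPerm n) → Bipartition c l r → DihedralOrder c l r (2 * n)
mainTheorem13 (suc (suc k)) (s≤s (s≤s z≤n)) c cox l r bip = words , words-distinct , words-complete
  where open DihedralGroup c l r cox bip
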